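{- $[\mathbf{Txt}\mathbf{It}\mathbf{Ex}_C]_{\mathbf{REC}} \setminus [\mathbf{Txt}\mathbf{G}\mathbf{CInd}\mathbf{Bc}_C]_{\mathbf{REC}} \neq \emptyset$.
   Context: Fix an acceptable numbering $(\varphi_e)_{e\in\mathbb{N}}$ of all partial computable functions. A number $e$ is a $C$-index if $\varphi_e$ is total with values in $\{0,1\}$; then $C_e=\{x:\varphi_e(x)=1\}$. $\mathbf{REC}$ is the collection of recursive subsets of $\mathbb{N}$; $\mathcal{P}$ denotes the partial computable functions. Fix a pause symbol $\#$. A text is a total function $T:\mathbb{N}\to\mathbb{N}\cup\{\#\}$, $\mathrm{content}(T)=\mathrm{range}(T)\setminus\{\#\}$, $T$ is a text for $L$ if $\mathrm{content}(T)=L$, $T[n]=(T(0),\dots,T(n-1))$. A learner is some $h\in\mathcal{P}$. Hypothesis sequences: full-information $\mathbf{G}(h,T)(i)=h(T[i])$; iterative $\mathbf{It}(h,T)(0)=h(\varepsilon)$ and $\mathbf{It}(h,T)(i)=h(\mathbf{It}(h,T)(i-1),T(i-1))$ for $i>0$. Restrictions on hypothesis sequence $p$ and text $T$: $\mathbf{Ex}_C$: there is $n_0$ with $p(n)=p(n_0)$ for all $n\ge n_0$ and $p(n_0)$ a $C$-index with $C_{p(n_0)}=\mathrm{content}(T)$; $\mathbf{Bc}_C$: there is $n_0$ such that for all $n\ge n_0$, $p(n)$ is a $C$-index with $C_{p(n)}=\mathrm{content}(T)$; $\mathbf{CInd}$: for all $i$, $p(i)$ is a $C$-index. Juxtaposition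 means conjunction. $h$ $\mathbf{Txt}\beta\delta$-learns $L$ iff $\delta(\beta(h,T),T)$ holds for every text $T$ for $L$; $[\mathbf{Txt}\beta\delta]_{\mathbf{REC}}$ is the set of all classes $\mathcal{L}\subseteq\mathbf{REC}$ for which some $h\in\mathcal{P}$ learns every $L\in\mathcal{L}$. -}

module Defs where

open import Data.Nat using (ℕ; zero; suc; _+_; _≤_)
open import Data.Fin using (Fin)
open import Data.Vec using (Vec; []; _∷_; lookup)
open import Data.List using (List; []; _∷_; _∷ʳ_)
open import Data.Maybe using (Maybe; just; nothing; _>>=_)
open import Data.Product using (Σ; _×_; _,_; ∃; ∃-syntax)
open import Data.Sum using (_⊎_)
open import Relation.Binary.PropositionalEquality using (_≡_)
open import Relation.Nullary using (¬_)
open import Function.Bundles using (_⇔_)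

data PR : ℕ → Set where
  zer    : ∀ {n} → PR n
  succ   : PR 1
  proj   : ∀ {n} → Fin n → PR n
  comp   : ∀ {n k} → PR k → Vec (PR n) k → PR n
  primrec : ∀ {n} → PR n → PR (suc (suc n)) → PR (suc n)
  mu     : ∀ {n} → PR (suc n) → PR n

mutual
  eval : ℕ → ∀ {n} → PR n → Vec ℕ n → Maybe ℕ
  eval zero    _ _ = nothing
  eval (suc k) zer xs = just 0
  eval (suc k) succ (x ∷ []) = just (suc x)
  eval (suc k) (proj i) xs = just (lookup xs i)
  eval (suc k) (comp f gs) xs = evalVec k gs xs >>= λ ys → eval k f ys
  eval (suc k) (primrec f g) (m ∷ xs) = evalRec k f g m xs
  eval (suc k) (mu f) xs = evalMu k k f 0 xs

  evalVec : ℕ → ∀ {n m} → Vec (PR n) m → Vec ℕ n → Maybe (Vec ℕ m)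
  evalVec k [] xs = just []
  evalVec k (g ∷ gs) xs =
    eval k g xs >>= λ y → evalVec k gs xs >>= λ ys → just (y ∷ ys)

  evalRec : ℕ → ∀ {n} → PR n → PR (suc (suc n)) → ℕ → Vec ℕ n → Maybe ℕ
  evalRec k f g zero xs = eval k f xs
  evalRec k f g (suc m) xs = evalRec k f g m xs >>= λ r → eval k g (m ∷ r ∷ xs)

  -- search bound, fuel for each evaluation, function, current candidate, args
  evalMu : ℕ → ℕ → ∀ {n} → PR (suc n) → ℕ → Vec ℕ n → Maybe ℕ
  evalMu zero    k f y xs = nothing
  evalMu (suc b) k f y xs with eval k f (y ∷ xs)
  ... | nothing      = nothing
  ... | just zero    = just y
  ... | just (suc _) = evalMu b k f (suc y) xs

Computes : ∀ {n} → PR n → Vec ℕ n → ℕ → Set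
Computes t xs y = ∃[ k ] (eval k t xs ≡ just y)

-- Numberings of partial functions: φ e x y  means  φ_e(x)↓ = y.

Numbering : Set₁
Numbering = ℕ → ℕ → ℕ → Set

-- Such a numbering numbers
-- exactly the partial computable functions.
Acceptable : Numbering → Set
Acceptable φ =
  (Σ (PR 2) λ U → ∀ e x y → φ e x y ⇔ Computes U (e ∷ x ∷ []) y)
  × (∀ (ψ : PR 2) → Σ (PR 1) λ s →
       (∀ i → ∃[ j ] Computes s (i ∷ []) j)
       × (∀ i j → Computes s (i ∷ []) j → ∀ x y → φ j x y ⇔ Computes ψ (i ∷ x ∷ []) y))

Lang : Set₁
Lang = ℕ → Set

Class : Set₁
Class = Lang → Set

Recursive : Lang → Set
Recursive L = Σ (PR 1) λ t →
  (∀ x → Computes t (x ∷ []) 0 ⊎ Computes t (x ∷ []) 1)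
  × (∀ x → Computes t (x ∷ []) 1 ⇔ L x)

CIndex : Numbering → ℕ → Set
CIndex φ e = ∀ x → φ e x 0 ⊎ φ e x 1

C : Numbering → ℕ → Lang
C φ e x = φ e x 1

-- Texts (nothing plays the role of the pause symbol #)

Text : Set
Text = ℕ → Maybe ℕ

content : Text → Lang
content T x = ∃[ n ] (T n ≡ just x)

SameSet : Lang → Lang → Set
SameSet A B = ∀ x → A x ⇔ B x

TextFor : Text → Lang → Set
TextFor T L = SameSet (content T) L

prefix : Text → ℕ → List (Maybe ℕ)
prefix T zero = []
prefix T (suc n) = prefix T n ∷ʳ T n

-- Fixed computable coding of learner inputs into ℕ (Cantor pairing)

tri : ℕ → ℕ
tri zero = zero
tri (suc n) = suc n + tri n

pair : ℕ → ℕ → ℕ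
pair a b = tri (a + b) + b

encD : Maybe ℕ → ℕ
encD nothing = 0
encD (just n) = suc n

codeSeq : List (Maybe ℕ) → ℕ
codeSeq [] = 0
codeSeq (d ∷ ds) = suc (pair (encD d) (codeSeq ds))

-- input of an iterative learner: ε, or (previous hypothesis, datum)
codeEmpty : ℕ
codeEmpty = 0

codeStep : ℕ → Maybe ℕ → ℕ
codeStep q d = suc (pair q (encD d))

-- Learners and (partial) hypothesis sequences: Seq i e means p(i)↓ = e

Learner : Set
Learner = PR 1

HypSeq : Set₁
HypSeq = ℕ → ℕ → Set

G : Learner → Text → HypSeq
G h T i e = Computes h (codeSeq (prefix T i) ∷ []) e

It : Learner → Text → HypSeq
It h T zero e = Computes h (codeEmpty ∷ []) e
It h T (suc i) e = ∃[ q ] (It h T i q × Computes h (codeStep q (T i) ∷ []) e)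

Criterion : Set₁
Criterion = HypSeq → Text → Set

ExC : Numbering → Criterion
ExC φ p T = Σ ℕ λ n₀ → Σ ℕ λ e →
  p n₀ e × (∀ n → n₀ ≤ n → p n e) × CIndex φ e × SameSet (C φ e) (content T)

BcC : Numbering → Criterion
BcC φ p T = Σ ℕ λ n₀ → ∀ n → n₀ ≤ n → Σ ℕ λ e →
  p n e × CIndex φ e × SameSet (C φ e) (content T)

CInd : Numbering → Criterion
CInd φ p T = ∀ i → Σ ℕ λ e → p i e × CIndex φ e

_∧_ : Criterion → Criterion → Criterion
(δ ∧ δ') p T = δ p T × δ' p T

Interaction : Set₁
Interaction = Learner → Text → HypSeq

Learns : Interaction → Criterion → Learner → Lang → Set
Learns β δ h L = ∀ (T : Text) → TextFor T L → δ (β h T) T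

⊆REC : Class → Set₁
⊆REC 𝓛 = ∀ L → 𝓛 L → Recursive L

-- 𝓛 ∈ [Txtβδ]_REC  (given 𝓛 ⊆ REC)
LearnableBy : Interaction → Criterion → Class → Set₁
LearnableBy β δ 𝓛 = Σ Learner λ h → ∀ L → 𝓛 L → Learns β δ h L

{-# OPTIONS --safe #-}
-- The class consists of the recursive sets L with a largest even element 2m such that m is a
-- C-index of L. An iterative learner only has to keep the largest i with 2i seen so far.
--
-- Let h output C-indices on all texts for sets of the class. By the recursion theorem there is e
-- with φₑ(2m) = [m = e] and φₑ(2n + 1) = 1 − φ_c(2n + 1), where c is the conjecture of h on the
-- prefix 2e, d₁, …, dₙ, with dₚ = 2p − 1 if φₑ(2p − 1) = 1 and a pause otherwise. This prefix
-- extends to a text for {2e, 2k} ∪ odd numbers, where k ≥ e is a C-index of that set (a second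
-- fixed point), so c is a C-index and φₑ is total by induction. Thus Cₑ is in the class, yet on
-- its text every conjecture of h at stage n + 1 disagrees with Cₑ at 2n + 1.
-- Ensuring k ≥ e uses a bound on the values φⱼ(0), j < e, which exists double-negatively.

module Submission where

open import Defs
open import Data.Nat using (ℕ; zero; suc; _+_; _∸_; _⊔_; _≤_; _<_; z≤n; s≤s; _≤′_; ≤′-refl; ≤′-step; _≤?_; _<?_)
open import Data.Nat.Properties
open import Data.Nat.Induction using (<-rec)
open import Data.Fin using (Fin; zero; suc)
open import Data.Vec using (Vec; []; _∷_; lookup)
open import Data.List using (List; []; _∷_; _∷ʳ_)
open import Data.Maybe using (Maybe; just; nothing; _>>=_)
open import Data.Maybe.Properties using (just-injective)
open import Data.Product using (Σ; _×_; _,_; proj₁; proj₂; ∃-syntax)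
open import Data.Sum using (_⊎_; inj₁; inj₂)
open import Data.Empty using (⊥; ⊥-elim)
open import Function.Bundles using (_⇔_; Equivalence; mk⇔)
open import Function.Construct.Identity using (⇔-id)
open import Function.Construct.Symmetry using (⇔-sym)
open import Function.Construct.Composition using (_⇔-∘_)
open import Relation.Nullary using (¬_; Dec; yes; no)
open import Relation.Nullary.Decidable using (¬¬-excluded-middle)
open import Relation.Binary.PropositionalEquality
open import Relation.Binary.Definitions using (tri<; tri≈; tri>)

private
  variable
    n m : ℕ

>>=-just-inv : {A B : Set} (ma : Maybe A) {f : A → Maybe B} {b : B} →
               (ma >>= f) ≡ just b → ∃[ a ] (ma ≡ just a × f a ≡ just b)
>>=-just-inv (just a) p = a , refl , p

>>=-just : {A B : Set} {ma : Maybe A} {f : A → Maybe B} {a : A} {b : B} →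
           ma ≡ just a → f a ≡ just b → (ma >>= f) ≡ just b
>>=-just refl q = q

mutual
  eval-suc : ∀ k (t : PR n) xs {y} → eval k t xs ≡ just y → eval (suc k) t xs ≡ just y
  eval-suc (suc k) zer xs p = p
  eval-suc (suc k) succ (x ∷ []) p = p
  eval-suc (suc k) (proj i) xs p = p
  eval-suc (suc k) (comp f gs) xs p with >>=-just-inv (evalVec k gs xs) p
  ... | ys , p₁ , p₂ = >>=-just (evalVec-suc k gs xs p₁) (eval-suc k f ys p₂)
  eval-suc (suc k) (primrec f g) (x ∷ xs) p = evalRec-suc k f g x xs p
  eval-suc (suc k) (mu f) xs p = evalMu-suc k k f 0 xs p

  evalVec-suc : ∀ k (gs : Vec (PR n) m) xs {ys} → evalVec k gs xs ≡ just ys → evalVec (suc k) gs xs ≡ just ys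
  evalVec-suc k [] xs p = p
  evalVec-suc k (g ∷ gs) xs p with >>=-just-inv (eval k g xs) p
  ... | y , p₁ , p₂ with >>=-just-inv (evalVec k gs xs) p₂
  ... | ys , p₃ , p₄ = >>=-just (eval-suc k g xs p₁) (>>=-just (evalVec-suc k gs xs p₃) p₄)

  evalRec-suc : ∀ k (f : PR n) g x xs {y} → evalRec k f g x xs ≡ just y → evalRec (suc k) f g x xs ≡ just y
  evalRec-suc k f g zero xs p = eval-suc k f xs p
  evalRec-suc k f g (suc x) xs p with >>=-just-inv (evalRec k f g x xs) p
  ... | r , p₁ , p₂ = >>=-just (evalRec-suc k f g x xs p₁) (eval-suc k g _ p₂)

  evalMu-suc : ∀ b k (f : PR (suc n)) y xs {r} → evalMu b k f y xs ≡ just r → evalMu (suc b) (suc k) f y xs ≡ just r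
  evalMu-suc (suc b) k f y xs p with eval k f (y ∷ xs) in eq
  ... | just zero rewrite eval-suc k f (y ∷ xs) eq = p
  ... | just (suc _) rewrite eval-suc k f (y ∷ xs) eq = evalMu-suc b k f (suc y) xs p

upward-closed : (P : ℕ → Set) → (∀ {k} → P k → P (suc k)) → ∀ {k k′} → k ≤ k′ → P k → P k′
upward-closed P step k≤k′ = go (≤⇒≤′ k≤k′)
  where
  go : ∀ {k k′} → k ≤′ k′ → P k → P k′
  go ≤′-refl p = p
  go (≤′-step k≤′k′) p = step (go k≤′k′ p)

eval-mono : ∀ {k k′} (t : PR n) xs {y} → k ≤ k′ → eval k t xs ≡ just y → eval k′ t xs ≡ just y
eval-mono t xs {y} = upward-closed (λ k → eval k t xs ≡ just y) (eval-suc _ t xs)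

evalVec-mono : ∀ {k k′} (gs : Vec (PR n) m) xs {ys} → k ≤ k′ → evalVec k gs xs ≡ just ys → evalVec k′ gs xs ≡ just ys
evalVec-mono gs xs {ys} = upward-closed (λ k → evalVec k gs xs ≡ just ys) (evalVec-suc _ gs xs)

evalRec-mono : ∀ {k k′} (f : PR n) g x xs {y} → k ≤ k′ → evalRec k f g x xs ≡ just y → evalRec k′ f g x xs ≡ just y
evalRec-mono f g x xs {y} = upward-closed (λ k → evalRec k f g x xs ≡ just y) (evalRec-suc _ f g x xs)

Computes-functional : {t : PR n} {xs : Vec ℕ n} {y y′ : ℕ} → Computes t xs y → Computes t xs y′ → y ≡ y′
Computes-functional {t = t} {xs} (k , p) (k′ , q) =
  just-injective (trans (sym (eval-mono t xs (m≤m⊔n k k′) p)) (eval-mono t xs (m≤n⊔m k k′) q))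

data ComputesAll {n} (xs : Vec ℕ n) : Vec (PR n) m → Vec ℕ m → Set where
  []  : ComputesAll xs [] []
  _∷_ : ∀ {g y} {gs : Vec (PR n) m} {ys} → Computes g xs y → ComputesAll xs gs ys → ComputesAll xs (g ∷ gs) (y ∷ ys)

ComputesAll⇒evalVec : {xs : Vec ℕ n} {gs : Vec (PR n) m} {ys : Vec ℕ m} →
                      ComputesAll xs gs ys → ∃[ k ] (evalVec k gs xs ≡ just ys)
ComputesAll⇒evalVec [] = 0 , refl
ComputesAll⇒evalVec {xs = xs} (_∷_ {g = g} {gs = gs} (k , p) cs) with ComputesAll⇒evalVec cs
... | k′ , q = k ⊔ k′ , >>=-just (eval-mono g xs (m≤m⊔n k k′) p) (>>=-just (evalVec-mono gs xs (m≤n⊔m k k′) q) refl)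

evalVec⇒ComputesAll : ∀ k {xs : Vec ℕ n} (gs : Vec (PR n) m) {ys : Vec ℕ m} →
                      evalVec k gs xs ≡ just ys → ComputesAll xs gs ys
evalVec⇒ComputesAll k [] refl = []
evalVec⇒ComputesAll k {xs} (g ∷ gs) p with >>=-just-inv (eval k g xs) p
... | y , p₁ , p₂ with >>=-just-inv (evalVec k gs xs) p₂
... | ys , p₃ , refl = (k , p₁) ∷ evalVec⇒ComputesAll k gs p₃

comp-computes : {f : PR m} {gs : Vec (PR n) m} {xs : Vec ℕ n} {ys : Vec ℕ m} {v : ℕ} →
                ComputesAll xs gs ys → Computes f ys v → Computes (comp f gs) xs v
comp-computes {f = f} {gs} {xs} {ys} cs (k′ , q) with ComputesAll⇒evalVec cs
... | k , p = suc (k ⊔ k′) , >>=-just (evalVec-mono gs xs (m≤m⊔n k k′) p) (eval-mono f ys (m≤n⊔m k k′) q)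

comp-computes-inv : {f : PR m} {gs : Vec (PR n) m} {xs : Vec ℕ n} {v : ℕ} →
                    Computes (comp f gs) xs v → ∃[ ys ] (ComputesAll xs gs ys × Computes f ys v)
comp-computes-inv {gs = gs} {xs} (suc k , p) with >>=-just-inv (evalVec k gs xs) p
... | ys , p₁ , p₂ = ys , evalVec⇒ComputesAll k gs p₁ , (k , p₂)

primrec-computes : {f : PR n} {g : PR (suc (suc n))} {xs : Vec ℕ n} (x : ℕ) (R : ℕ → ℕ) →
                   Computes f xs (R 0) → (∀ i → i < x → Computes g (i ∷ R i ∷ xs) (R (suc i))) →
                   Computes (primrec f g) (x ∷ xs) (R x)
primrec-computes {f = f} {g} {xs} x R base step = suc (proj₁ (upTo x ≤-refl)) , proj₂ (upTo x ≤-refl)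
  where
  upTo : ∀ j → j ≤ x → ∃[ k ] (evalRec k f g j xs ≡ just (R j))
  upTo zero _ = base
  upTo (suc j) j<x with upTo j (<⇒≤ j<x) | step j j<x
  ... | k , p | k′ , q = k ⊔ k′ , >>=-just (evalRec-mono f g j xs (m≤m⊔n k k′) p) (eval-mono g _ (m≤n⊔m k k′) q)

data Prim : ℕ → Set where
  zeroᵖ : Prim n
  sucᵖ  : Prim 1
  projᵖ : Fin n → Prim n
  compᵖ : Prim m → Vec (Prim n) m → Prim n
  recᵖ  : Prim n → Prim (suc (suc n)) → Prim (suc n)

mutual
  ⌜_⌝ : Prim n → PR n
  ⌜ zeroᵖ ⌝ = zer
  ⌜ sucᵖ ⌝ = succ
  ⌜ projᵖ i ⌝ = proj i
  ⌜ compᵖ f gs ⌝ = comp ⌜ f ⌝ ⌜ gs ⌝*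
  ⌜ recᵖ f g ⌝ = primrec ⌜ f ⌝ ⌜ g ⌝

  ⌜_⌝* : Vec (Prim n) m → Vec (PR n) m
  ⌜ [] ⌝* = []
  ⌜ g ∷ gs ⌝* = ⌜ g ⌝ ∷ ⌜ gs ⌝*

mutual
  ⟦_⟧ : Prim n → Vec ℕ n → ℕ
  ⟦ zeroᵖ ⟧ xs = 0
  ⟦ sucᵖ ⟧ (x ∷ []) = suc x
  ⟦ projᵖ i ⟧ xs = lookup xs i
  ⟦ compᵖ f gs ⟧ xs = ⟦ f ⟧ (⟦ gs ⟧* xs)
  ⟦ recᵖ f g ⟧ (x ∷ xs) = ⟦rec⟧ f g x xs

  ⟦_⟧* : Vec (Prim n) m → Vec ℕ n → Vec ℕ m
  ⟦ [] ⟧* xs = []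
  ⟦ g ∷ gs ⟧* xs = ⟦ g ⟧ xs ∷ ⟦ gs ⟧* xs

  ⟦rec⟧ : Prim n → Prim (suc (suc n)) → ℕ → Vec ℕ n → ℕ
  ⟦rec⟧ f g zero xs = ⟦ f ⟧ xs
  ⟦rec⟧ f g (suc x) xs = ⟦ g ⟧ (x ∷ ⟦rec⟧ f g x xs ∷ xs)

mutual
  ⟦⟧-computes : (t : Prim n) (xs : Vec ℕ n) → Computes ⌜ t ⌝ xs (⟦ t ⟧ xs)
  ⟦⟧-computes zeroᵖ xs = 1 , refl
  ⟦⟧-computes sucᵖ (x ∷ []) = 1 , refl
  ⟦⟧-computes (projᵖ i) xs = 1 , refl
  ⟦⟧-computes (compᵖ f gs) xs = comp-computes (⟦⟧*-computesAll gs xs) (⟦⟧-computes f _)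
  ⟦⟧-computes (recᵖ f g) (x ∷ xs) =
    primrec-computes x (λ j → ⟦rec⟧ f g j xs) (⟦⟧-computes f xs) (λ i _ → ⟦⟧-computes g _)

  ⟦⟧*-computesAll : (gs : Vec (Prim n) m) (xs : Vec ℕ n) → ComputesAll xs ⌜ gs ⌝* (⟦ gs ⟧* xs)
  ⟦⟧*-computesAll [] xs = []
  ⟦⟧*-computesAll (g ∷ gs) xs = ⟦⟧-computes g xs ∷ ⟦⟧*-computesAll gs xs

⟦⟧≡-computes : (t : Prim n) (xs : Vec ℕ n) {v : ℕ} → ⟦ t ⟧ xs ≡ v → Computes ⌜ t ⌝ xs v
⟦⟧≡-computes t xs refl = ⟦⟧-computes t xs

v₀ : Prim (suc n)
v₀ = projᵖ zero

v₁ : Prim (suc (suc n))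
v₁ = projᵖ (suc zero)

v₂ : Prim (suc (suc (suc n)))
v₂ = projᵖ (suc (suc zero))

v₃ : Prim (suc (suc (suc (suc n))))
v₃ = projᵖ (suc (suc (suc zero)))

app₁ : Prim 1 → Prim n → Prim n
app₁ f a = compᵖ f (a ∷ [])

app₂ : Prim 2 → Prim n → Prim n → Prim n
app₂ f a b = compᵖ f (a ∷ b ∷ [])

#_ : ℕ → Prim n
# zero = zeroᵖ
# suc c = app₁ sucᵖ (# c)

#-correct : ∀ c (xs : Vec ℕ n) → ⟦ # c ⟧ xs ≡ c
#-correct zero xs = refl
#-correct (suc c) xs = cong suc (#-correct c xs)

addᵖ : Prim 2
addᵖ = recᵖ v₀ (app₁ sucᵖ v₁)

addᵖ-correct : ∀ a b → ⟦ addᵖ ⟧ (a ∷ b ∷ []) ≡ a + b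
addᵖ-correct zero b = refl
addᵖ-correct (suc a) b = cong suc (addᵖ-correct a b)

predᵖ : Prim 1
predᵖ = recᵖ zeroᵖ v₀

predᵖ-correct : ∀ a → ⟦ predᵖ ⟧ (a ∷ []) ≡ a ∸ 1
predᵖ-correct zero = refl
predᵖ-correct (suc a) = refl

-- recursion runs on the first argument, so the subtrahend comes first
monusᵖ : Prim 2
monusᵖ = recᵖ v₀ (app₁ predᵖ v₁)

monusᵖ-correct : ∀ b a → ⟦ monusᵖ ⟧ (b ∷ a ∷ []) ≡ a ∸ b
monusᵖ-correct zero a = refl
monusᵖ-correct (suc b) a = begin
  ⟦ predᵖ ⟧ (⟦ monusᵖ ⟧ (b ∷ a ∷ []) ∷ [])  ≡⟨ predᵖ-correct (⟦ monusᵖ ⟧ (b ∷ a ∷ [])) ⟩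
  ⟦ monusᵖ ⟧ (b ∷ a ∷ []) ∸ 1              ≡⟨ cong (_∸ 1) (monusᵖ-correct b a) ⟩
  a ∸ b ∸ 1                                ≡⟨ ∸-+-assoc a b 1 ⟩
  a ∸ (b + 1)                              ≡⟨ cong (a ∸_) (+-comm b 1) ⟩
  a ∸ suc b                                ∎
  where open ≡-Reasoning

infixl 6 _⊕_ _⊖_

_⊕_ : Prim n → Prim n → Prim n
a ⊕ b = app₂ addᵖ a b

_⊖_ : Prim n → Prim n → Prim n
a ⊖ b = app₂ monusᵖ b a

⊕-correct : (a b : Prim n) (xs : Vec ℕ n) → ⟦ a ⊕ b ⟧ xs ≡ ⟦ a ⟧ xs + ⟦ b ⟧ xs
⊕-correct a b xs = addᵖ-correct (⟦ a ⟧ xs) (⟦ b ⟧ xs)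

⊖-correct : (a b : Prim n) (xs : Vec ℕ n) → ⟦ a ⊖ b ⟧ xs ≡ ⟦ a ⟧ xs ∸ ⟦ b ⟧ xs
⊖-correct a b xs = monusᵖ-correct (⟦ b ⟧ xs) (⟦ a ⟧ xs)

ifZero : ℕ → ℕ → ℕ → ℕ
ifZero zero a b = a
ifZero (suc _) a b = b

if0_then_else_ : Prim n → Prim n → Prim n → Prim n
if0 c then a else b = compᵖ (recᵖ v₀ v₃) (c ∷ a ∷ b ∷ [])

if0-correct : (c a b : Prim n) (xs : Vec ℕ n) →
              ⟦ if0 c then a else b ⟧ xs ≡ ifZero (⟦ c ⟧ xs) (⟦ a ⟧ xs) (⟦ b ⟧ xs)
if0-correct c a b xs with ⟦ c ⟧ xs
... | zero = refl
... | suc _ = refl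

isZero : ℕ → ℕ
isZero zero = 1
isZero (suc _) = 0

isZeroᵖ : Prim n → Prim n
isZeroᵖ a = # 1 ⊖ a

isZeroᵖ-correct : (a : Prim n) (xs : Vec ℕ n) → ⟦ isZeroᵖ a ⟧ xs ≡ isZero (⟦ a ⟧ xs)
isZeroᵖ-correct a xs rewrite ⊖-correct (# 1) a xs | #-correct 1 xs with ⟦ a ⟧ xs
... | zero = refl
... | suc z = 0∸n≡0 z

IsBit : ℕ → Set
IsBit v = v ≡ 0 ⊎ v ≡ 1

isZero-bit : ∀ x → IsBit (isZero x)
isZero-bit zero = inj₂ refl
isZero-bit (suc x) = inj₁ refl

leqBit : ℕ → ℕ → ℕ
leqBit a b = isZero (a ∸ b)

leqᵖ : Prim n → Prim n → Prim n
leqᵖ a b = isZeroᵖ (a ⊖ b)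

leqᵖ-correct : (a b : Prim n) (xs : Vec ℕ n) → ⟦ leqᵖ a b ⟧ xs ≡ leqBit (⟦ a ⟧ xs) (⟦ b ⟧ xs)
leqᵖ-correct a b xs = trans (isZeroᵖ-correct (a ⊖ b) xs) (cong isZero (⊖-correct a b xs))

leqBit-≤ : ∀ {a b} → a ≤ b → leqBit a b ≡ 1
leqBit-≤ a≤b rewrite m≤n⇒m∸n≡0 a≤b = refl

leqBit-> : ∀ {a b} → b < a → leqBit a b ≡ 0
leqBit-> {suc a} {zero} _ = refl
leqBit-> {suc a} {suc b} (s≤s b<a) = leqBit-> b<a

eqBit : ℕ → ℕ → ℕ
eqBit a b = isZero ((a ∸ b) + (b ∸ a))

eqᵖ : Prim n → Prim n → Prim n
eqᵖ a b = isZeroᵖ ((a ⊖ b) ⊕ (b ⊖ a))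

eqᵖ-correct : (a b : Prim n) (xs : Vec ℕ n) → ⟦ eqᵖ a b ⟧ xs ≡ eqBit (⟦ a ⟧ xs) (⟦ b ⟧ xs)
eqᵖ-correct a b xs = trans (isZeroᵖ-correct ((a ⊖ b) ⊕ (b ⊖ a)) xs)
  (cong isZero (trans (⊕-correct (a ⊖ b) (b ⊖ a) xs) (cong₂ _+_ (⊖-correct a b xs) (⊖-correct b a xs))))

eqBit-refl : ∀ a → eqBit a a ≡ 1
eqBit-refl a rewrite n∸n≡0 a = refl

eqBit-bit : ∀ a b → IsBit (eqBit a b)
eqBit-bit a b = isZero-bit ((a ∸ b) + (b ∸ a))

eqBit≡suc⇒≡ : ∀ a b {z} → eqBit a b ≡ suc z → a ≡ b
eqBit≡suc⇒≡ a b p with (a ∸ b) + (b ∸ a) in eq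
... | zero = ≤-antisym (m∸n≡0⇒m≤n (m+n≡0⇒m≡0 (a ∸ b) eq)) (m∸n≡0⇒m≤n (m+n≡0⇒n≡0 (a ∸ b) eq))

maxᵖ : Prim n → Prim n → Prim n
maxᵖ a b = a ⊕ (b ⊖ a)

m+[n∸m]≡m⊔n : ∀ m n → m + (n ∸ m) ≡ m ⊔ n
m+[n∸m]≡m⊔n zero n = refl
m+[n∸m]≡m⊔n (suc m) zero = cong suc (+-identityʳ m)
m+[n∸m]≡m⊔n (suc m) (suc n) = cong suc (m+[n∸m]≡m⊔n m n)

maxᵖ-correct : (a b : Prim n) (xs : Vec ℕ n) → ⟦ maxᵖ a b ⟧ xs ≡ ⟦ a ⟧ xs ⊔ ⟦ b ⟧ xs
maxᵖ-correct a b xs = trans (⊕-correct a (b ⊖ a) xs)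
  (trans (cong (⟦ a ⟧ xs +_) (⊖-correct b a xs)) (m+[n∸m]≡m⊔n (⟦ a ⟧ xs) (⟦ b ⟧ xs)))

parity : ℕ → ℕ
parity zero = 0
parity (suc x) = isZero (parity x)

parityᵖ : Prim 1
parityᵖ = recᵖ zeroᵖ (isZeroᵖ v₁)

parityᵖ-correct : ∀ x → ⟦ parityᵖ ⟧ (x ∷ []) ≡ parity x
parityᵖ-correct zero = refl
parityᵖ-correct (suc x) rewrite isZeroᵖ-correct {n = 2} v₁ (x ∷ ⟦ parityᵖ ⟧ (x ∷ []) ∷ []) =
  cong isZero (parityᵖ-correct x)

half : ℕ → ℕ
half zero = 0
half (suc x) = half x + parity x

halfᵖ : Prim 1
halfᵖ = recᵖ zeroᵖ (v₁ ⊕ app₁ parityᵖ v₀)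

halfᵖ-correct : ∀ x → ⟦ halfᵖ ⟧ (x ∷ []) ≡ half x
halfᵖ-correct zero = refl
halfᵖ-correct (suc x) rewrite ⊕-correct {n = 2} v₁ (app₁ parityᵖ v₀) (x ∷ ⟦ halfᵖ ⟧ (x ∷ []) ∷ []) =
  cong₂ _+_ (halfᵖ-correct x) (parityᵖ-correct x)

double : ℕ → ℕ
double zero = zero
double (suc m) = suc (suc (double m))

doubleᵖ : Prim n → Prim n
doubleᵖ a = a ⊕ a

doubleᵖ-correct : (a : Prim n) (xs : Vec ℕ n) → ⟦ doubleᵖ a ⟧ xs ≡ double (⟦ a ⟧ xs)
doubleᵖ-correct a xs = trans (⊕-correct a a xs) (m+m≡double (⟦ a ⟧ xs))
  where
  m+m≡double : ∀ m → m + m ≡ double m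
  m+m≡double zero = refl
  m+m≡double (suc m) rewrite +-suc m m = cong (λ k → suc (suc k)) (m+m≡double m)

data ParityView : ℕ → Set where
  even : ∀ m → ParityView (double m)
  odd  : ∀ m → ParityView (suc (double m))

parityView : ∀ x → ParityView x
parityView zero = even zero
parityView (suc x) with parityView x
... | even m = odd m
... | odd m = even (suc m)

parity-double : ∀ m → parity (double m) ≡ 0
parity-double zero = refl
parity-double (suc m) rewrite parity-double m = refl

parity-suc-double : ∀ m → parity (suc (double m)) ≡ 1
parity-suc-double m = cong isZero (parity-double m)

half-double : ∀ m → half (double m) ≡ m
half-double zero = refl
half-double (suc m) rewrite parity-double m | +-identityʳ (half (double m)) | half-double m = +-comm m 1

half-suc-double : ∀ m → half (suc (double m)) ≡ m
half-suc-double m rewrite parity-double m | half-double m = +-identityʳ m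

double-injective : ∀ {a b} → double a ≡ double b → a ≡ b
double-injective {a} {b} p = trans (sym (half-double a)) (trans (cong half p) (half-double b))

double-mono-≤ : ∀ {a b} → a ≤ b → double a ≤ double b
double-mono-≤ z≤n = z≤n
double-mono-≤ (s≤s a≤b) = s≤s (s≤s (double-mono-≤ a≤b))

triᵖ : Prim 1
triᵖ = recᵖ zeroᵖ (app₁ sucᵖ v₀ ⊕ v₁)

triᵖ-correct : ∀ x → ⟦ triᵖ ⟧ (x ∷ []) ≡ tri x
triᵖ-correct zero = refl
triᵖ-correct (suc x) rewrite ⊕-correct {n = 2} (app₁ sucᵖ v₀) v₁ (x ∷ ⟦ triᵖ ⟧ (x ∷ []) ∷ []) =
  cong (suc x +_) (triᵖ-correct x)

pairᵖ : Prim 2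
pairᵖ = app₁ triᵖ (v₀ ⊕ v₁) ⊕ v₁

pairᵖ-correct : ∀ a b → ⟦ pairᵖ ⟧ (a ∷ b ∷ []) ≡ pair a b
pairᵖ-correct a b rewrite addᵖ-correct a b | triᵖ-correct (a + b) = addᵖ-correct (tri (a + b)) b

triInv : ℕ → ℕ
triInv zero = 0
triInv (suc w) = triInv w + leqBit (tri (suc (triInv w))) (suc w)

triInvᵖ : Prim 1
triInvᵖ = recᵖ zeroᵖ (v₁ ⊕ leqᵖ (app₁ triᵖ (app₁ sucᵖ v₁)) (app₁ sucᵖ v₀))

triInvᵖ-correct : ∀ w → ⟦ triInvᵖ ⟧ (w ∷ []) ≡ triInv w
triInvᵖ-correct zero = refl
triInvᵖ-correct (suc w) = begin
  ⟦ v₁ ⊕ leqᵖ t s ⟧ xs                       ≡⟨ ⊕-correct v₁ (leqᵖ t s) xs ⟩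
  r + ⟦ leqᵖ t s ⟧ xs                        ≡⟨ cong (r +_) (leqᵖ-correct t s xs) ⟩
  r + leqBit (⟦ triᵖ ⟧ (suc r ∷ [])) (suc w) ≡⟨ cong (λ k → r + leqBit k (suc w)) (triᵖ-correct (suc r)) ⟩
  r + leqBit (tri (suc r)) (suc w)           ≡⟨ cong (λ k → k + leqBit (tri (suc k)) (suc w)) (triInvᵖ-correct w) ⟩
  triInv (suc w)                             ∎
  where
  open ≡-Reasoning
  r = ⟦ triInvᵖ ⟧ (w ∷ [])
  xs = w ∷ r ∷ []
  t s : Prim 2
  t = app₁ triᵖ (app₁ sucᵖ v₁)
  s = app₁ sucᵖ v₀

tri-suc-≤ : ∀ {s s′} → s < s′ → tri (suc s) ≤ tri s′
tri-suc-≤ {s} {suc s′} (s≤s s≤s′) with m≤n⇒m<n∨m≡n s≤s′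
... | inj₂ refl = ≤-refl
... | inj₁ s<s′ = ≤-trans (tri-suc-≤ s<s′) (m≤n+m (tri s′) (suc s′))

-- w lies in row s of the triangle enumeration behind pair
InRow : ℕ → ℕ → Set
InRow s w = tri s ≤ w × w < tri (suc s)

InRow-unique : ∀ {s s′ w} → InRow s w → InRow s′ w → s ≡ s′
InRow-unique {s} {s′} (lo , hi) (lo′ , hi′) with <-cmp s s′
... | tri< s<s′ _ _ = ⊥-elim (<⇒≱ hi (≤-trans (tri-suc-≤ s<s′) lo′))
... | tri≈ _ s≡s′ _ = s≡s′
... | tri> _ _ s>s′ = ⊥-elim (<⇒≱ hi′ (≤-trans (tri-suc-≤ s>s′) lo))

InRow-suc : ∀ {s w} → InRow s w → InRow (s + leqBit (tri (suc s)) (suc w)) (suc w)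
InRow-suc {s} {w} (lo , hi) with tri (suc s) ≤? suc w
... | yes next≤ rewrite leqBit-≤ next≤ | +-comm s 1 = next≤ , ≤-trans (s≤s hi) (s≤s (m≤n+m (tri (suc s)) (suc s)))
... | no next≰ rewrite leqBit-> (≰⇒> next≰) | +-identityʳ s = m≤n⇒m≤1+n lo , ≰⇒> next≰

InRow-triInv : ∀ w → InRow (triInv w) w
InRow-triInv zero = z≤n , s≤s z≤n
InRow-triInv (suc w) = InRow-suc {triInv w} (InRow-triInv w)

InRow-pair : ∀ a b → InRow (a + b) (pair a b)
InRow-pair a b = m≤m+n (tri (a + b)) b , pair<next
  where
  pair<next : pair a b < tri (suc (a + b))
  pair<next = subst (pair a b <_) (+-comm (tri (a + b)) (suc (a + b))) (+-monoʳ-< (tri (a + b)) (s≤s (m≤n+m b a)))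

triInv-pair : ∀ a b → triInv (pair a b) ≡ a + b
triInv-pair a b = InRow-unique (InRow-triInv (pair a b)) (InRow-pair a b)

unpair₂ : ℕ → ℕ
unpair₂ w = w ∸ tri (triInv w)

unpair₁ : ℕ → ℕ
unpair₁ w = triInv w ∸ unpair₂ w

unpair₂-pair : ∀ a b → unpair₂ (pair a b) ≡ b
unpair₂-pair a b rewrite triInv-pair a b = m+n∸m≡n (tri (a + b)) b

unpair₁-pair : ∀ a b → unpair₁ (pair a b) ≡ a
unpair₁-pair a b rewrite unpair₂-pair a b | triInv-pair a b = m+n∸n≡m a b

unpair₂ᵖ : Prim 1
unpair₂ᵖ = v₀ ⊖ app₁ triᵖ (app₁ triInvᵖ v₀)

unpair₁ᵖ : Prim 1
unpair₁ᵖ = app₁ triInvᵖ v₀ ⊖ app₁ unpair₂ᵖ v₀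

unpair₂ᵖ-correct : ∀ w → ⟦ unpair₂ᵖ ⟧ (w ∷ []) ≡ unpair₂ w
unpair₂ᵖ-correct w rewrite monusᵖ-correct (⟦ triᵖ ⟧ (⟦ triInvᵖ ⟧ (w ∷ []) ∷ [])) w
                         | triᵖ-correct (⟦ triInvᵖ ⟧ (w ∷ [])) | triInvᵖ-correct w = refl

unpair₁ᵖ-correct : ∀ w → ⟦ unpair₁ᵖ ⟧ (w ∷ []) ≡ unpair₁ w
unpair₁ᵖ-correct w = trans (⊖-correct (app₁ triInvᵖ v₀) (app₁ unpair₂ᵖ v₀) (w ∷ []))
  (cong₂ _∸_ (triInvᵖ-correct w) (unpair₂ᵖ-correct w))

module Acceptability (φ : Numbering) (acc : Acceptable φ) where

  U : PR 2
  U = proj₁ (proj₁ acc)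

  φ⇔U : ∀ e x y → φ e x y ⇔ Computes U (e ∷ x ∷ []) y
  φ⇔U = proj₂ (proj₁ acc)

  φ-functional : ∀ {e x y y′} → φ e x y → φ e x y′ → y ≡ y′
  φ-functional {e} {x} {y} {y′} p q = Computes-functional (Equivalence.to (φ⇔U e x y) p) (Equivalence.to (φ⇔U e x y′) q)

  programOf : ℕ → PR 1
  programOf j = comp U (⌜ # j ⌝ ∷ ⌜ v₀ ⌝ ∷ [])

  programOf-correct : ∀ j x y → φ j x y ⇔ Computes (programOf j) (x ∷ []) y
  programOf-correct j x y = mk⇔ to from
    where
    args : ComputesAll (x ∷ []) (⌜ # j ⌝ ∷ ⌜ v₀ ⌝ ∷ []) (j ∷ x ∷ [])
    args = ⟦⟧≡-computes (# j) (x ∷ []) (#-correct j (x ∷ [])) ∷ ⟦⟧-computes v₀ (x ∷ []) ∷ []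

    to : φ j x y → Computes (programOf j) (x ∷ []) y
    to φjxy = comp-computes args (Equivalence.to (φ⇔U j x y) φjxy)

    from : Computes (programOf j) (x ∷ []) y → φ j x y
    from c with comp-computes-inv c
    ... | _ , cj ∷ cx ∷ [] , cU = Equivalence.from (φ⇔U j x y)
      (subst₂ (λ a b → Computes U (a ∷ b ∷ []) y)
              (trans (Computes-functional cj (⟦⟧-computes (# j) (x ∷ []))) (#-correct j (x ∷ [])))
              (Computes-functional cx (⟦⟧-computes v₀ (x ∷ []))) cU)

  CIndex⇒Recursive : ∀ {j} → CIndex φ j → Recursive (C φ j)
  CIndex⇒Recursive {j} ci = programOf j , bit , λ x → ⇔-sym (programOf-correct j x 1)
    where
    bit : ∀ x → Computes (programOf j) (x ∷ []) 0 ⊎ Computes (programOf j) (x ∷ []) 1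
    bit x with ci x
    ... | inj₁ φjx0 = inj₁ (Equivalence.to (programOf-correct j x 0) φjx0)
    ... | inj₂ φjx1 = inj₂ (Equivalence.to (programOf-correct j x 1) φjx1)

  CIndex-value : ∀ {c} → CIndex φ c → ∀ y → ∃[ w ] (IsBit w × φ c y w)
  CIndex-value ci y with ci y
  ... | inj₁ φcy0 = 0 , inj₁ refl , φcy0
  ... | inj₂ φcy1 = 1 , inj₂ refl , φcy1

  bit-valued⇒CIndex : ∀ {c} → (∀ y → ∃[ w ] (IsBit w × φ c y w)) → CIndex φ c
  bit-valued⇒CIndex values y with values y
  ... | _ , inj₁ refl , φcy0 = inj₁ φcy0
  ... | _ , inj₂ refl , φcy1 = inj₂ φcy1

  flip-differs : ∀ {c e y w} → IsBit w → φ c y w → φ e y (isZero w) → ¬ (C φ c y ⇔ C φ e y)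
  flip-differs (inj₁ refl) φcy0 φey1 same = 0≢1+n (φ-functional φcy0 (Equivalence.from same φey1))
  flip-differs (inj₂ refl) φcy1 φey0 same = 0≢1+n (φ-functional φey0 (Equivalence.to same φcy1))

  smnᵖ : PR 2 → PR 1
  smnᵖ ψ = proj₁ (proj₂ acc ψ)

  smn : PR 2 → ℕ → ℕ
  smn ψ i = proj₁ (proj₁ (proj₂ (proj₂ acc ψ)) i)

  smnᵖ-computes : ∀ ψ i → Computes (smnᵖ ψ) (i ∷ []) (smn ψ i)
  smnᵖ-computes ψ i = proj₂ (proj₁ (proj₂ (proj₂ acc ψ)) i)

  smn-spec : ∀ ψ i x y → φ (smn ψ i) x y ⇔ Computes ψ (i ∷ x ∷ []) y
  smn-spec ψ i = proj₂ (proj₂ (proj₂ acc ψ)) i (smn ψ i) (smnᵖ-computes ψ i)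

  recursion-theorem : (ψ : PR 2) → ∃[ e ] (∀ x y → φ e x y ⇔ Computes ψ (e ∷ x ∷ []) y)
  recursion-theorem ψ = e , λ x y → mk⇔ (to x y) (from x y)
    where
    -- θ(i, x) = ψ(φᵢ(i), x), and k is an index of smn θ, so that φₖ(k) = smn θ k = e
    diag : PR 2
    diag = comp U (⌜ v₀ ⌝ ∷ ⌜ v₀ ⌝ ∷ [])
    θ : PR 2
    θ = comp ψ (diag ∷ ⌜ v₁ ⌝ ∷ [])
    k : ℕ
    k = smn (comp (smnᵖ θ) (⌜ v₁ ⌝ ∷ [])) 0
    e : ℕ
    e = smn θ k
    φₖ[k]≡e : Computes U (k ∷ k ∷ []) e
    φₖ[k]≡e = Equivalence.to (φ⇔U k k e) (Equivalence.from (smn-spec (comp (smnᵖ θ) (⌜ v₁ ⌝ ∷ [])) 0 k e)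
      (comp-computes (⟦⟧-computes v₁ (0 ∷ k ∷ []) ∷ []) (smnᵖ-computes θ k)))
    args : ∀ x → ComputesAll (k ∷ x ∷ []) (diag ∷ ⌜ v₁ ⌝ ∷ []) (e ∷ x ∷ [])
    args x = comp-computes (⟦⟧-computes v₀ (k ∷ x ∷ []) ∷ ⟦⟧-computes v₀ (k ∷ x ∷ []) ∷ []) φₖ[k]≡e
           ∷ ⟦⟧-computes v₁ (k ∷ x ∷ []) ∷ []

    to : ∀ x y → φ e x y → Computes ψ (e ∷ x ∷ []) y
    to x y φexy with comp-computes-inv (Equivalence.to (smn-spec θ k x y) φexy)
    ... | _ , c₁ ∷ c₂ ∷ [] , cψ with args x
    ...   | c₁′ ∷ c₂′ ∷ [] =
      subst₂ (λ a b → Computes ψ (a ∷ b ∷ []) y) (Computes-functional c₁ c₁′) (Computes-functional c₂ c₂′) cψ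

    from : ∀ x y → Computes ψ (e ∷ x ∷ []) y → φ e x y
    from x y c = Equivalence.from (smn-spec θ k x y) (comp-computes (args x) c)

HalfOfMaxEven : Lang → ℕ → Set
HalfOfMaxEven L m = L (double m) × (∀ i → L (double i) → i ≤ m)

SelfDescribing : Numbering → Class
SelfDescribing φ L = Recursive L × Σ ℕ λ m → HalfOfMaxEven L m × CIndex φ m × SameSet (C φ m) L

learnStep : ℕ → Maybe ℕ → ℕ
learnStep q nothing = q
learnStep q (just x) = ifZero (parity x) (q ⊔ half x) q

learnStep-even : ∀ q m → learnStep q (just (double m)) ≡ q ⊔ m
learnStep-even q m rewrite parity-double m | half-double m = refl

learnStep-odd : ∀ q m → learnStep q (just (suc (double m))) ≡ q
learnStep-odd q m rewrite parity-suc-double m = refl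

learnStep-≥ : ∀ q d → q ≤ learnStep q d
learnStep-≥ q nothing = ≤-refl
learnStep-≥ q (just x) with parityView x
... | even m rewrite learnStep-even q m = m≤m⊔n q m
... | odd m rewrite learnStep-odd q m = ≤-refl

learnStepᵖ : Prim 2
learnStepᵖ = if0 v₁ then v₀ else (if0 app₁ parityᵖ datum then maxᵖ v₀ (app₁ halfᵖ datum) else v₀)
  where
  datum : Prim 2
  datum = v₁ ⊖ # 1

learnStepᵖ-correct : ∀ q d → ⟦ learnStepᵖ ⟧ (q ∷ encD d ∷ []) ≡ learnStep q d
learnStepᵖ-correct q nothing = refl
learnStepᵖ-correct q (just x) = begin
  ⟦ if0 app₁ parityᵖ datum then maxᵖ v₀ (app₁ halfᵖ datum) else v₀ ⟧ xs
    ≡⟨ if0-correct (app₁ parityᵖ datum) (maxᵖ v₀ (app₁ halfᵖ datum)) v₀ xs ⟩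
  ifZero (⟦ parityᵖ ⟧ (x ∷ [])) (⟦ maxᵖ v₀ (app₁ halfᵖ datum) ⟧ xs) q
    ≡⟨ cong₂ (λ a b → ifZero a b q) (parityᵖ-correct x)
             (trans (maxᵖ-correct v₀ (app₁ halfᵖ datum) xs) (cong (q ⊔_) (halfᵖ-correct x))) ⟩
  ifZero (parity x) (q ⊔ half x) q
    ∎
  where
  open ≡-Reasoning
  xs = q ∷ suc x ∷ []
  datum : Prim 2
  datum = v₁ ⊖ # 1

learnerᵖ : Prim 1
learnerᵖ = if0 v₀ then # 0 else app₂ learnStepᵖ (app₁ unpair₁ᵖ input) (app₁ unpair₂ᵖ input)
  where
  input : Prim 1
  input = app₁ predᵖ v₀

learnerᵖ-step : ∀ q d → ⟦ learnerᵖ ⟧ (codeStep q d ∷ []) ≡ learnStep q d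
learnerᵖ-step q d = begin
  ⟦ learnStepᵖ ⟧ (⟦ unpair₁ᵖ ⟧ (w ∷ []) ∷ ⟦ unpair₂ᵖ ⟧ (w ∷ []) ∷ [])
    ≡⟨ cong₂ (λ a b → ⟦ learnStepᵖ ⟧ (a ∷ b ∷ [])) (trans (unpair₁ᵖ-correct w) (unpair₁-pair q (encD d)))
                                                   (trans (unpair₂ᵖ-correct w) (unpair₂-pair q (encD d))) ⟩
  ⟦ learnStepᵖ ⟧ (q ∷ encD d ∷ [])
    ≡⟨ learnStepᵖ-correct q d ⟩
  learnStep q d
    ∎
  where
  open ≡-Reasoning
  w = pair q (encD d)

hypotheses : Text → ℕ → ℕ
hypotheses T zero = 0
hypotheses T (suc i) = learnStep (hypotheses T i) (T i)

It-hypotheses : ∀ T i → It ⌜ learnerᵖ ⌝ T i (hypotheses T i)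
It-hypotheses T zero = ⟦⟧-computes learnerᵖ (codeEmpty ∷ [])
It-hypotheses T (suc i) = hypotheses T i , It-hypotheses T i ,
  ⟦⟧≡-computes learnerᵖ (codeStep (hypotheses T i) (T i) ∷ []) (learnerᵖ-step (hypotheses T i) (T i))

hypotheses-≤ : ∀ {L : Lang} {m} T → (∀ i x → T i ≡ just x → L x) → (∀ i → L (double i) → i ≤ m) →
               ∀ i → hypotheses T i ≤ m
hypotheses-≤ T inL max zero = z≤n
hypotheses-≤ T inL max (suc i) with T i in Ti≡
... | nothing = hypotheses-≤ T inL max i
... | just x with parityView x
...   | even k rewrite learnStep-even (hypotheses T i) k = ⊔-lub (hypotheses-≤ T inL max i) (max k (inL i _ Ti≡))
...   | odd k rewrite learnStep-odd (hypotheses T i) k = hypotheses-≤ T inL max i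

stable-at-bound : ∀ (f : ℕ → ℕ) {b n k} → (∀ i → f i ≤ f (suc i)) → (∀ i → f i ≤ b) →
                  f n ≡ b → n ≤ k → f k ≡ b
stable-at-bound f {b} mono bound fn≡b n≤k = upward-closed (λ i → f i ≡ b) step n≤k fn≡b
  where
  step : ∀ {i} → f i ≡ b → f (suc i) ≡ b
  step {i} fi≡b = ≤-antisym (bound (suc i)) (subst (_≤ f (suc i)) fi≡b (mono i))

SelfDescribing-It-learnable : (φ : Numbering) → LearnableBy It (ExC φ) (SelfDescribing φ)
SelfDescribing-It-learnable φ = ⌜ learnerᵖ ⌝ , learns
  where
  learns : ∀ L → SelfDescribing φ L → Learns It (ExC φ) ⌜ learnerᵖ ⌝ L
  learns L (_ , m , (L[2m] , max) , ci , C≡L) T T-for-L with Equivalence.from (T-for-L (double m)) L[2m]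
  ... | n , Tn≡2m = suc n , m , It-from (suc n) ≤-refl , It-from , ci , λ x → ⇔-sym (T-for-L x) ⇔-∘ C≡L x
    where
    bound : ∀ i → hypotheses T i ≤ m
    bound = hypotheses-≤ T (λ i x Ti≡x → Equivalence.to (T-for-L x) (i , Ti≡x)) max
    reach : hypotheses T (suc n) ≡ m
    reach rewrite Tn≡2m | learnStep-even (hypotheses T n) m = m≤n⇒m⊔n≡n (bound n)
    It-from : ∀ k → suc n ≤ k → It ⌜ learnerᵖ ⌝ T k m
    It-from k n<k = subst (It ⌜ learnerᵖ ⌝ T k)
      (stable-at-bound (hypotheses T) (λ i → learnStep-≥ _ (T i)) bound reach n<k) (It-hypotheses T k)

segment : Text → ℕ → ℕ → List (Maybe ℕ)
segment T a zero = []
segment T a (suc l) = T a ∷ segment T (suc a) l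

segment-suc : ∀ T a l → segment T a (suc l) ≡ segment T a l ∷ʳ T (a + l)
segment-suc T a zero rewrite +-identityʳ a = refl
segment-suc T a (suc l) rewrite segment-suc T (suc a) l | +-suc a l = refl

prefix≡segment : ∀ T n → prefix T n ≡ segment T 0 n
prefix≡segment T zero = refl
prefix≡segment T (suc n) rewrite prefix≡segment T n = sym (segment-suc T 0 n)

prefix-cong : ∀ {T T′} n → (∀ i → i < n → T i ≡ T′ i) → prefix T n ≡ prefix T′ n
prefix-cong zero _ = refl
prefix-cong (suc n) T≗T′ rewrite prefix-cong n (λ i i<n → T≗T′ i (m≤n⇒m≤1+n i<n)) | T≗T′ n ≤-refl = refl

-- the code of T(n + 1 − j), …, T(n); codeSeq folds from the right, so it is built from the end
suffixCode : Text → ℕ → ℕ → ℕ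
suffixCode T n zero = 0
suffixCode T n (suc j) = suc (pair (encD (T (n ∸ j))) (suffixCode T n j))

codeSeq-segment : ∀ T n j → j ≤ n → codeSeq (segment T (suc (n ∸ j)) j) ≡ suffixCode T n j
codeSeq-segment T n zero _ = refl
codeSeq-segment T n (suc j) j<n = cong₂ (λ p c → suc (pair (encD (T p)) c)) (sym n∸j≡)
  (trans (cong (λ p → codeSeq (segment T (suc p) j)) (sym n∸j≡)) (codeSeq-segment T n j (<⇒≤ j<n)))
  where
  n∸j≡ : n ∸ j ≡ suc (n ∸ suc j)
  n∸j≡ = +-∸-assoc 1 j<n

codeSeq-prefix : ∀ T n → codeSeq (prefix T (suc n)) ≡ suc (pair (encD (T 0)) (suffixCode T n n))
codeSeq-prefix T n rewrite prefix≡segment T (suc n) | sym (codeSeq-segment T n n ≤-refl) | n∸n≡0 n = refl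

splice : Text → ℕ → Text → Text
splice T n T′ i with i ≤? n
... | yes _ = T i
... | no _ = T′ (i ∸ suc n)

splice-≤ : ∀ T n T′ {i} → i ≤ n → splice T n T′ i ≡ T i
splice-≤ T n T′ {i} i≤n with i ≤? n
... | yes _ = refl
... | no i≰n = ⊥-elim (i≰n i≤n)

splice-> : ∀ T n T′ j → splice T n T′ (suc n + j) ≡ T′ j
splice-> T n T′ j with suc n + j ≤? n
... | yes n<n = ⊥-elim (<-irrefl refl (≤-trans n<n (m≤m+n n j)))
... | no _ = cong T′ (m+n∸m≡n (suc n) j)

splice-content : ∀ T n T′ {x} → content (splice T n T′) x → content T x ⊎ content T′ x
splice-content T n T′ (i , eq) with i ≤? n
... | yes _ = inj₁ (i , eq)
... | no _ = inj₂ (i ∸ suc n , eq)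

prefix-splice : ∀ T n T′ → prefix (splice T n T′) (suc n) ≡ prefix T (suc n)
prefix-splice T n T′ = prefix-cong (suc n) (λ i i≤n → splice-≤ T n T′ (≤-pred i≤n))

onBit : ℕ → ℕ → Maybe ℕ
onBit zero x = nothing
onBit (suc _) x = just x

onBit-just : ∀ {v z x} → IsBit v → onBit v z ≡ just x → v ≡ 1 × x ≡ z
onBit-just (inj₁ refl) ()
onBit-just (inj₂ refl) refl = refl , refl

-- b is indexed by text position; b 0 is never read
diagText : ℕ → (ℕ → ℕ) → Text
diagText e b zero = just (double e)
diagText e b (suc i) = onBit (b (suc i)) (suc (double i))

encD-diagText : ∀ e b {p} → 0 < p → encD (diagText e b p) ≡ ifZero (b p) 0 (double p)
encD-diagText e b {suc p} _ with b (suc p)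
... | zero = refl
... | suc _ = refl

module Diagonal (φ : Numbering) (acc : Acceptable φ) (h : Learner) where
  open Acceptability φ acc

  BitsUpTo : ℕ → (ℕ → ℕ) → ℕ → Set
  BitsUpTo e b n = ∀ p → 0 < p → p ≤ n → φ e (double p ∸ 1) (b p)

  entryᵖ : Prim 3
  entryᵖ = app₁ sucᵖ (app₂ pairᵖ (if0 v₀ then # 0 else doubleᵖ v₁) v₂)

  entryᵖ-correct : ∀ bit p r → ⟦ entryᵖ ⟧ (bit ∷ p ∷ r ∷ []) ≡ suc (pair (ifZero bit 0 (double p)) r)
  entryᵖ-correct bit p r = cong suc (trans (pairᵖ-correct (⟦ if0 v₀ then # 0 else doubleᵖ v₁ ⟧ xs) r) (cong (λ a → pair a r) entry≡))
    where
    xs = bit ∷ p ∷ r ∷ []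
    entry≡ : ⟦ if0 v₀ then # 0 else doubleᵖ v₁ ⟧ xs ≡ ifZero bit 0 (double p)
    entry≡ = trans (if0-correct v₀ (# 0) (doubleᵖ v₁) xs) (cong (ifZero bit 0) (doubleᵖ-correct v₁ xs))

  -- on (j, r, n, e) the entry for position n ∸ j, whose datum is 2(n ∸ j) − 1
  positionᵖ : Prim 4
  positionᵖ = v₂ ⊖ v₀

  datumᵖ : Prim 4
  datumᵖ = doubleᵖ positionᵖ ⊖ # 1

  tailStep : PR 4
  tailStep = comp ⌜ entryᵖ ⌝ (comp U (⌜ v₃ ⌝ ∷ ⌜ datumᵖ ⌝ ∷ []) ∷ ⌜ positionᵖ ⌝ ∷ ⌜ v₁ ⌝ ∷ [])

  tailCodeᵖ : PR 3
  tailCodeᵖ = primrec zer tailStep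

  tailCodeᵖ-correct : ∀ {e b n} → BitsUpTo e b n → Computes tailCodeᵖ (n ∷ n ∷ e ∷ []) (suffixCode (diagText e b) n n)
  tailCodeᵖ-correct {e} {b} {n} bits = primrec-computes n (suffixCode (diagText e b) n) (1 , refl) step
    where
    step : ∀ j → j < n → Computes tailStep (j ∷ suffixCode (diagText e b) n j ∷ n ∷ e ∷ []) (suffixCode (diagText e b) n (suc j))
    step j j<n = comp-computes (bit ∷ ⟦⟧≡-computes positionᵖ xs (⊖-correct v₂ v₀ xs) ∷ ⟦⟧-computes v₁ xs ∷ [])
                               (⟦⟧≡-computes entryᵖ (b pos ∷ pos ∷ r ∷ []) entry≡)
      where
      r = suffixCode (diagText e b) n j
      xs = j ∷ r ∷ n ∷ e ∷ []
      pos = n ∸ j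
      0<pos : 0 < pos
      0<pos = m<n⇒0<n∸m j<n
      datum≡ : ⟦ datumᵖ ⟧ xs ≡ double pos ∸ 1
      datum≡ = trans (⊖-correct (doubleᵖ positionᵖ) (# 1) xs)
                     (cong (_∸ 1) (trans (doubleᵖ-correct positionᵖ xs) (cong double (⊖-correct v₂ v₀ xs))))
      entry≡ : ⟦ entryᵖ ⟧ (b pos ∷ pos ∷ r ∷ []) ≡ suc (pair (encD (diagText e b pos)) r)
      entry≡ = trans (entryᵖ-correct (b pos) pos r) (cong (λ a → suc (pair a r)) (sym (encD-diagText e b 0<pos)))
      bit : Computes (comp U (⌜ v₃ ⌝ ∷ ⌜ datumᵖ ⌝ ∷ [])) xs (b pos)
      bit = comp-computes (⟦⟧-computes v₃ xs ∷ ⟦⟧≡-computes datumᵖ xs datum≡ ∷ [])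
                          (Equivalence.to (φ⇔U e _ _) (bits pos 0<pos (m∸n≤m n j)))

  headᵖ : Prim 2
  headᵖ = app₁ sucᵖ (app₂ pairᵖ (app₁ sucᵖ (doubleᵖ v₁)) v₀)

  prefixCodeᵖ : PR 2
  prefixCodeᵖ = comp ⌜ headᵖ ⌝ (comp tailCodeᵖ (⌜ v₀ ⌝ ∷ ⌜ v₀ ⌝ ∷ ⌜ v₁ ⌝ ∷ []) ∷ ⌜ v₁ ⌝ ∷ [])

  prefixCodeᵖ-correct : ∀ {e b n} → BitsUpTo e b n → Computes prefixCodeᵖ (n ∷ e ∷ []) (codeSeq (prefix (diagText e b) (suc n)))
  prefixCodeᵖ-correct {e} {b} {n} bits = comp-computes (tail ∷ ⟦⟧-computes v₁ xs ∷ []) (⟦⟧≡-computes headᵖ _ head≡)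
    where
    xs = n ∷ e ∷ []
    tail : Computes (comp tailCodeᵖ (⌜ v₀ ⌝ ∷ ⌜ v₀ ⌝ ∷ ⌜ v₁ ⌝ ∷ [])) xs (suffixCode (diagText e b) n n)
    tail = comp-computes (⟦⟧-computes v₀ xs ∷ ⟦⟧-computes v₀ xs ∷ ⟦⟧-computes v₁ xs ∷ []) (tailCodeᵖ-correct bits)
    t = suffixCode (diagText e b) n n
    head≡ : ⟦ headᵖ ⟧ (t ∷ e ∷ []) ≡ codeSeq (prefix (diagText e b) (suc n))
    head≡ = begin
      ⟦ headᵖ ⟧ (t ∷ e ∷ [])                         ≡⟨ cong suc (pairᵖ-correct (suc (⟦ doubleᵖ v₁ ⟧ (t ∷ e ∷ []))) t) ⟩
      suc (pair (suc (⟦ doubleᵖ v₁ ⟧ (t ∷ e ∷ []))) t) ≡⟨ cong (λ a → suc (pair (suc a) t)) (doubleᵖ-correct v₁ (t ∷ e ∷ [])) ⟩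
      suc (pair (suc (double e)) t)                  ≡⟨ codeSeq-prefix (diagText e b) n ⟨
      codeSeq (prefix (diagText e b) (suc n))        ∎
      where open ≡-Reasoning

  evenCase : PR 2
  evenCase = ⌜ eqᵖ v₁ (doubleᵖ v₀) ⌝

  oddCase : PR 4
  oddCase = comp ⌜ isZeroᵖ v₀ ⌝ (comp U (conjecture ∷ ⌜ v₃ ⌝ ∷ []) ∷ [])
    where
    conjecture : PR 4
    conjecture = comp h (comp prefixCodeᵖ (⌜ app₁ halfᵖ v₃ ⌝ ∷ ⌜ v₂ ⌝ ∷ []) ∷ [])

  -- recursion on the parity bit is a lazy conditional: oddCase, which need not halt, only runs on odd y
  diagonalᵖ : PR 2
  diagonalᵖ = comp (primrec evenCase oddCase) (⌜ app₁ parityᵖ v₁ ⌝ ∷ ⌜ v₀ ⌝ ∷ ⌜ v₁ ⌝ ∷ [])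

  diagonalᵖ-even : ∀ e m → Computes diagonalᵖ (e ∷ double m ∷ []) (eqBit (double m) (double e))
  diagonalᵖ-even e m = comp-computes args (primrec-computes 0 (λ _ → eqBit (double m) (double e)) base (λ _ ()))
    where
    xs = e ∷ double m ∷ []
    args : ComputesAll xs (⌜ app₁ parityᵖ v₁ ⌝ ∷ ⌜ v₀ ⌝ ∷ ⌜ v₁ ⌝ ∷ []) (0 ∷ e ∷ double m ∷ [])
    args = ⟦⟧≡-computes (app₁ parityᵖ v₁) xs (trans (parityᵖ-correct (double m)) (parity-double m))
         ∷ ⟦⟧-computes v₀ xs ∷ ⟦⟧-computes v₁ xs ∷ []
    base : Computes evenCase xs (eqBit (double m) (double e))
    base = ⟦⟧≡-computes (eqᵖ v₁ (doubleᵖ v₀)) xs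
             (trans (eqᵖ-correct v₁ (doubleᵖ v₀) xs) (cong (eqBit (double m)) (doubleᵖ-correct v₀ xs)))

  diagonalᵖ-odd : ∀ {e b n c w} → BitsUpTo e b n → Computes h (codeSeq (prefix (diagText e b) (suc n)) ∷ []) c →
                  φ c (suc (double n)) w → Computes diagonalᵖ (e ∷ suc (double n) ∷ []) (isZero w)
  diagonalᵖ-odd {e} {b} {n} {c} {w} bits hc φcw =
    comp-computes args (primrec-computes 1 R (⟦⟧-computes (eqᵖ v₁ (doubleᵖ v₀)) xs) step)
    where
    y = suc (double n)
    xs = e ∷ y ∷ []
    args : ComputesAll xs (⌜ app₁ parityᵖ v₁ ⌝ ∷ ⌜ v₀ ⌝ ∷ ⌜ v₁ ⌝ ∷ []) (1 ∷ e ∷ y ∷ [])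
    args = ⟦⟧≡-computes (app₁ parityᵖ v₁) xs (trans (parityᵖ-correct y) (parity-suc-double n))
         ∷ ⟦⟧-computes v₀ xs ∷ ⟦⟧-computes v₁ xs ∷ []
    R : ℕ → ℕ
    R zero = ⟦ eqᵖ v₁ (doubleᵖ v₀) ⟧ xs
    R (suc _) = isZero w
    ys = 0 ∷ R 0 ∷ e ∷ y ∷ []
    prefixCode : Computes (comp prefixCodeᵖ (⌜ app₁ halfᵖ v₃ ⌝ ∷ ⌜ v₂ ⌝ ∷ [])) ys
                          (codeSeq (prefix (diagText e b) (suc n)))
    prefixCode = comp-computes (⟦⟧≡-computes (app₁ halfᵖ v₃) ys (trans (halfᵖ-correct y) (half-suc-double n))
                                ∷ ⟦⟧-computes v₂ ys ∷ [])
                               (prefixCodeᵖ-correct bits)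
    step : ∀ i → i < 1 → Computes oddCase (i ∷ R i ∷ e ∷ y ∷ []) (R (suc i))
    step zero _ = comp-computes (comp-computes (comp-computes (prefixCode ∷ []) hc ∷ ⟦⟧-computes v₃ ys ∷ [])
                                              (Equivalence.to (φ⇔U c y w) φcw) ∷ [])
                               (⟦⟧≡-computes (isZeroᵖ v₀) (w ∷ []) (isZeroᵖ-correct v₀ (w ∷ [])))
    step (suc i) (s≤s ())

¬¬-values-bounded : (R : ℕ → ℕ → Set) → (∀ {j y y′} → R j y → R j y′ → y ≡ y′) →
                    ∀ n → ¬ ¬ (∃[ B ] (∀ j → j < n → ∀ y → R j y → y < B))
¬¬-values-bounded R functional zero k = k (0 , λ j ())
¬¬-values-bounded R functional (suc n) k = ¬¬-values-bounded R functional n extend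
  where
  extend : ∃[ B ] (∀ j → j < n → ∀ y → R j y → y < B) → ⊥
  extend (B , bounded) = ¬¬-excluded-middle decide
    where
    decide : Dec (∃[ v ] R n v) → ⊥
    decide (yes (v , Rnv)) = k (B ⊔ suc v , bounded′)
      where
      bounded′ : ∀ j → j < suc n → ∀ y → R j y → y < B ⊔ suc v
      bounded′ j j<1+n y Rjy with m<1+n⇒m<n∨m≡n j<1+n
      ... | inj₁ j<n = ≤-trans (bounded j j<n y Rjy) (m≤m⊔n B (suc v))
      ... | inj₂ refl = ≤-trans (s≤s (≤-reflexive (functional Rjy Rnv))) (m≤n⊔m B (suc v))
    decide (no noValue) = k (B , bounded′)
      where
      bounded′ : ∀ j → j < suc n → ∀ y → R j y → y < B
      bounded′ j j<1+n y Rjy with m<1+n⇒m<n∨m≡n j<1+n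
      ... | inj₁ j<n = bounded j j<n y Rjy
      ... | inj₂ refl = ⊥-elim (noValue (y , Rjy))

data Companion (e k y : ℕ) : Set where
  at-e   : y ≡ double e → Companion e k y
  at-k   : y ≡ double k → Companion e k y
  at-odd : ∀ m → y ≡ suc (double m) → Companion e k y

double≢suc-double : ∀ i m → double i ≢ suc (double m)
double≢suc-double i m eq = 0≢1+n (trans (sym (parity-double i)) (trans (cong parity eq) (parity-suc-double m)))

Companion-double-≤ : ∀ {e k i} → e ≤ k → Companion e k (double i) → i ≤ k
Companion-double-≤ e≤k (at-e eq) = ≤-trans (≤-reflexive (double-injective eq)) e≤k
Companion-double-≤ e≤k (at-k eq) = ≤-reflexive (double-injective eq)
Companion-double-≤ {i = i} e≤k (at-odd m eq) = ⊥-elim (double≢suc-double i m eq)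

companionBit : ℕ → ℕ → ℕ → ℕ
companionBit e k y = ifZero (parity y) (ifZero (eqBit y (double e)) (eqBit y (double k)) 1) 1

companionBit-even : ∀ e k m → companionBit e k (double m) ≡ ifZero (eqBit (double m) (double e)) (eqBit (double m) (double k)) 1
companionBit-even e k m = cong (λ p → ifZero p (ifZero (eqBit (double m) (double e)) (eqBit (double m) (double k)) 1) 1) (parity-double m)

companionBit-odd : ∀ e k m → companionBit e k (suc (double m)) ≡ 1
companionBit-odd e k m = cong (λ p → ifZero p (ifZero (eqBit y (double e)) (eqBit y (double k)) 1) 1) (parity-suc-double m)
  where
  y = suc (double m)

companionBit-bit : ∀ e k y → IsBit (companionBit e k y)
companionBit-bit e k y with parity y | eqBit y (double e) | eqBit-bit y (double k)
... | zero | zero | bit = bit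
... | zero | suc _ | _ = inj₂ refl
... | suc _ | _ | _ = inj₂ refl

eqBit-cases : ∀ a b c → ifZero (eqBit a b) (eqBit a c) 1 ≡ 1 → a ≡ b ⊎ a ≡ c
eqBit-cases a b c p with eqBit a b in eq
... | zero = inj₂ (eqBit≡suc⇒≡ a c p)
... | suc _ = inj₁ (eqBit≡suc⇒≡ a b eq)

companionBit≡1⇒Companion : ∀ e k y → companionBit e k y ≡ 1 → Companion e k y
companionBit≡1⇒Companion e k y bit≡1 with parityView y
... | odd m = at-odd m refl
... | even m with eqBit-cases (double m) (double e) (double k) (trans (sym (companionBit-even e k m)) bit≡1)
...   | inj₁ eq = at-e eq
...   | inj₂ eq = at-k eq

Companion⇒companionBit≡1 : ∀ e k y → Companion e k y → companionBit e k y ≡ 1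
Companion⇒companionBit≡1 e k y (at-e refl) =
  trans (companionBit-even e k e) (cong (λ b → ifZero b (eqBit (double e) (double k)) 1) (eqBit-refl (double e)))
Companion⇒companionBit≡1 e k y (at-k refl) = trans (companionBit-even e k k) (either (eqBit (double k) (double e)) (eqBit-refl (double k)))
  where
  either : ∀ a {b} → b ≡ 1 → ifZero a b 1 ≡ 1
  either zero b≡1 = b≡1
  either (suc _) _ = refl
Companion⇒companionBit≡1 e k y (at-odd m refl) = companionBit-odd e k m

companionᵖ : ℕ → Prim 2
companionᵖ e = if0 app₁ parityᵖ v₁ then (if0 eqᵖ v₁ (# double e) then eqᵖ v₁ (doubleᵖ v₀) else # 1) else # 1

companionᵖ-correct : ∀ e k y → ⟦ companionᵖ e ⟧ (k ∷ y ∷ []) ≡ companionBit e k y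
companionᵖ-correct e k y = begin
  ⟦ companionᵖ e ⟧ xs
    ≡⟨ if0-correct (app₁ parityᵖ v₁) inner (# 1) xs ⟩
  ifZero (⟦ parityᵖ ⟧ (y ∷ [])) (⟦ inner ⟧ xs) 1
    ≡⟨ cong₂ (λ p i → ifZero p i 1) (parityᵖ-correct y)
             (if0-correct (eqᵖ v₁ (# double e)) (eqᵖ v₁ (doubleᵖ v₀)) (# 1) xs) ⟩
  ifZero (parity y) (ifZero (⟦ eqᵖ v₁ (# double e) ⟧ xs) (⟦ eqᵖ v₁ (doubleᵖ v₀) ⟧ xs) 1) 1
    ≡⟨ cong₂ (λ a b → ifZero (parity y) (ifZero a b 1) 1)
             (trans (eqᵖ-correct v₁ (# double e) xs) (cong (eqBit y) (#-correct (double e) xs)))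
             (trans (eqᵖ-correct v₁ (doubleᵖ v₀) xs) (cong (eqBit y) (doubleᵖ-correct v₀ xs))) ⟩
  companionBit e k y
    ∎
  where
  open ≡-Reasoning
  xs = k ∷ y ∷ []
  inner : Prim 2
  inner = if0 eqᵖ v₁ (# double e) then eqᵖ v₁ (doubleᵖ v₀) else # 1

-- For k < e it outputs B everywhere, and no φⱼ with j < e takes a value ≥ B at 0: a fixed point is ≥ e.
guardedCompanionᵖ : ℕ → ℕ → Prim 2
guardedCompanionᵖ e B = if0 leqᵖ (# e) v₀ then # B else companionᵖ e

guardedCompanionᵖ-correct : ∀ e B k y →
                            ⟦ guardedCompanionᵖ e B ⟧ (k ∷ y ∷ []) ≡ ifZero (leqBit e k) B (companionBit e k y)
guardedCompanionᵖ-correct e B k y = trans (if0-correct (leqᵖ (# e) v₀) (# B) (companionᵖ e) xs)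
  (cong₃ (trans (leqᵖ-correct (# e) v₀ xs) (cong (λ a → leqBit a k) (#-correct e xs)))
         (#-correct B xs) (companionᵖ-correct e k y))
  where
  xs = k ∷ y ∷ []
  cong₃ : ∀ {a a′ b b′ c c′} → a ≡ a′ → b ≡ b′ → c ≡ c′ → ifZero a b c ≡ ifZero a′ b′ c′
  cong₃ refl refl refl = refl

kTail : ℕ → Text
kTail k zero = just (double k)
kTail k (suc m) = just (suc (double m))

companionText : ℕ → ℕ → (ℕ → ℕ) → ℕ → Text
companionText e k b n = splice (diagText e b) n (kTail k)

diagText⊆Companion : ∀ e k b {x} → content (diagText e b) x → Companion e k x
diagText⊆Companion e k b (zero , refl) = at-e refl
diagText⊆Companion e k b (suc i , eq) with b (suc i)
... | suc _ = at-odd i (sym (just-injective eq))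

kTail⊆Companion : ∀ e k {x} → content (kTail k) x → Companion e k x
kTail⊆Companion e k (zero , refl) = at-k refl
kTail⊆Companion e k (suc m , refl) = at-odd m refl

companionText-for : ∀ e k b n → TextFor (companionText e k b n) (Companion e k)
companionText-for e k b n x = mk⇔ to from
  where
  T = companionText e k b n
  to : content T x → Companion e k x
  to inT with splice-content (diagText e b) n (kTail k) inT
  ... | inj₁ inDiag = diagText⊆Companion e k b inDiag
  ... | inj₂ inTail = kTail⊆Companion e k inTail
  from : Companion e k x → content T x
  from (at-e refl) = 0 , splice-≤ (diagText e b) n (kTail k) z≤n
  from (at-k refl) = suc n + 0 , splice-> (diagText e b) n (kTail k) 0
  from (at-odd m refl) = suc n + suc m , splice-> (diagText e b) n (kTail k) (suc m)

module CompanionIndex (φ : Numbering) (acc : Acceptable φ) (e B : ℕ)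
                      (bounded : ∀ j → j < e → ∀ y → φ j 0 y → y < B) where
  open Acceptability φ acc

  k : ℕ
  k = proj₁ (recursion-theorem ⌜ guardedCompanionᵖ e B ⌝)

  k-fixed : ∀ x y → φ k x y ⇔ Computes ⌜ guardedCompanionᵖ e B ⌝ (k ∷ x ∷ []) y
  k-fixed = proj₂ (recursion-theorem ⌜ guardedCompanionᵖ e B ⌝)

  φk-value : ∀ y → φ k y (ifZero (leqBit e k) B (companionBit e k y))
  φk-value y = Equivalence.from (k-fixed y _)
    (⟦⟧≡-computes (guardedCompanionᵖ e B) (k ∷ y ∷ []) (guardedCompanionᵖ-correct e B k y))

  e≤k : e ≤ k
  e≤k with e ≤? k
  ... | yes e≤k = e≤k
  ... | no e≰k = ⊥-elim (<-irrefl refl (bounded k (≰⇒> e≰k) B φk0B))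
    where
    φk0B : φ k 0 B
    φk0B = subst (φ k 0) (cong (λ a → ifZero a B (companionBit e k 0)) (leqBit-> (≰⇒> e≰k))) (φk-value 0)

  φk-companion : ∀ y → φ k y (companionBit e k y)
  φk-companion y = subst (φ k y) (cong (λ a → ifZero a B (companionBit e k y)) (leqBit-≤ e≤k)) (φk-value y)

  k-CIndex : CIndex φ k
  k-CIndex y with companionBit-bit e k y
  ... | inj₁ bit≡0 = inj₁ (subst (φ k y) bit≡0 (φk-companion y))
  ... | inj₂ bit≡1 = inj₂ (subst (φ k y) bit≡1 (φk-companion y))

  C[k]⇔Companion : SameSet (C φ k) (Companion e k)
  C[k]⇔Companion y = mk⇔ (λ φky1 → companionBit≡1⇒Companion e k y (φ-functional (φk-companion y) φky1))
                         (λ cy → subst (φ k y) (Companion⇒companionBit≡1 e k y cy) (φk-companion y))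

  C[k]-SelfDescribing : SelfDescribing φ (C φ k)
  C[k]-SelfDescribing = CIndex⇒Recursive k-CIndex , k ,
    (Equivalence.from (C[k]⇔Companion (double k)) (at-k refl) ,
     λ i C[2i] → Companion-double-≤ e≤k (Equivalence.to (C[k]⇔Companion (double i)) C[2i])) ,
    k-CIndex , λ y → ⇔-id _

module NotLearnable (φ : Numbering) (acc : Acceptable φ) (h : Learner)
                    (h-learns : ∀ L → SelfDescribing φ L → Learns G (CInd φ ∧ BcC φ) h L) where
  open Acceptability φ acc
  open Diagonal φ acc h

  e : ℕ
  e = proj₁ (recursion-theorem diagonalᵖ)

  e-fixed : ∀ x y → φ e x y ⇔ Computes diagonalᵖ (e ∷ x ∷ []) y
  e-fixed = proj₂ (recursion-theorem diagonalᵖ)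

  φe-even : ∀ m → φ e (double m) (eqBit (double m) (double e))
  φe-even m = Equivalence.from (e-fixed _ _) (diagonalᵖ-even e m)

  C[e][2e] : C φ e (double e)
  C[e][2e] = subst (φ e (double e)) (eqBit-refl (double e)) (φe-even e)

  C[e][2i]⇒i≡e : ∀ {i} → C φ e (double i) → i ≡ e
  C[e][2i]⇒i≡e {i} C[2i] = double-injective (eqBit≡suc⇒≡ _ _ (φ-functional (φe-even i) C[2i]))

  BitValue : ℕ → Set
  BitValue y = ∃[ v ] (IsBit v × φ e y v)

  bitsBelow : ∀ {y} → (∀ {z} → z < y → BitValue z) → ℕ → ℕ
  bitsBelow {y} below p with double p ∸ 1 <? y
  ... | yes z<y = proj₁ (below z<y)
  ... | no _ = 0

  bitsBelow-correct : ∀ {y} (below : ∀ {z} → z < y → BitValue z) p → double p ∸ 1 < y →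
                      φ e (double p ∸ 1) (bitsBelow below p)
  bitsBelow-correct {y} below p z<y with double p ∸ 1 <? y
  ... | yes z<y′ = proj₂ (proj₂ (below z<y′))
  ... | no z≮y = ⊥-elim (z≮y z<y)

  module _ (B : ℕ) (bounded : ∀ j → j < e → ∀ y → φ j 0 y → y < B) where
    open CompanionIndex φ acc e B bounded

    -- the learner's conjecture on a prefix of diagText is a C-index, because the prefix extends to a text for C φ k
    odd-value : ∀ {b n} → BitsUpTo e b n → BitValue (suc (double n))
    odd-value {b} {n} bits = isZero w , isZero-bit w , Equivalence.from (e-fixed _ _) (diagonalᵖ-odd bits hc φcw)
      where
      T = companionText e k b n
      T-for : TextFor T (C φ k)
      T-for x = ⇔-sym (C[k]⇔Companion x) ⇔-∘ companionText-for e k b n x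
      conjecture : ∃[ c ] (G h T (suc n) c × CIndex φ c)
      conjecture = proj₁ (h-learns (C φ k) C[k]-SelfDescribing T T-for) (suc n)
      c = proj₁ conjecture
      hc : Computes h (codeSeq (prefix (diagText e b) (suc n)) ∷ []) c
      hc = subst (λ l → Computes h (codeSeq l ∷ []) c) (prefix-splice (diagText e b) n (kTail k)) (proj₁ (proj₂ conjecture))
      w = proj₁ (CIndex-value (proj₂ (proj₂ conjecture)) (suc (double n)))
      φcw : φ c (suc (double n)) w
      φcw = proj₂ (proj₂ (CIndex-value (proj₂ (proj₂ conjecture)) (suc (double n))))

    bit-valued : ∀ y → BitValue y
    bit-valued = <-rec BitValue step
      where
      step : ∀ y → (∀ {z} → z < y → BitValue z) → BitValue y
      step y below with parityView y
      ... | even m = eqBit (double m) (double e) , eqBit-bit (double m) (double e) , φe-even m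
      ... | odd n = odd-value λ p _ p≤n →
        bitsBelow-correct below p (s≤s (≤-trans (m∸n≤m (double p) 1) (double-mono-≤ p≤n)))

    e-CIndex : CIndex φ e
    e-CIndex = bit-valued⇒CIndex bit-valued

    C[e]-SelfDescribing : SelfDescribing φ (C φ e)
    C[e]-SelfDescribing = CIndex⇒Recursive e-CIndex , e , (C[e][2e] , λ i C[2i] → ≤-reflexive (C[e][2i]⇒i≡e C[2i])) ,
                          e-CIndex , λ y → ⇔-id _

    diagBits : ℕ → ℕ
    diagBits p = proj₁ (bit-valued (double p ∸ 1))

    diagonalText : Text
    diagonalText = diagText e diagBits

    diagBits-spec : ∀ p → IsBit (diagBits p) × φ e (double p ∸ 1) (diagBits p)
    diagBits-spec p = proj₂ (bit-valued (double p ∸ 1))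

    diagonalText-for : TextFor diagonalText (C φ e)
    diagonalText-for x = mk⇔ to from
      where
      to : content diagonalText x → C φ e x
      to (zero , refl) = C[e][2e]
      to (suc i , Ti≡x) with onBit-just (proj₁ (diagBits-spec (suc i))) Ti≡x
      ... | bit≡1 , refl = subst (φ e x) bit≡1 (proj₂ (diagBits-spec (suc i)))
      from : C φ e x → content diagonalText x
      from C[x] with parityView x
      ... | even m = 0 , cong (λ i → just (double i)) (sym (C[e][2i]⇒i≡e C[x]))
      ... | odd m = suc m , cong (λ v → onBit v x) (φ-functional (proj₂ (diagBits-spec (suc m))) C[x])

    absurd : ⊥
    absurd = refute (proj₂ (h-learns (C φ e) C[e]-SelfDescribing diagonalText diagonalText-for))
      where
      refute : BcC φ (G h diagonalText) diagonalText → ⊥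
      refute (n₀ , converged) = flip-differs w-bit φcw φey (diagonalText-for y ⇔-∘ C[c]≡content y)
        where
        y = suc (double n₀)
        conjecture = converged (suc n₀) (n≤1+n n₀)
        c = proj₁ conjecture
        C[c]≡content : SameSet (C φ c) (content diagonalText)
        C[c]≡content = proj₂ (proj₂ (proj₂ conjecture))
        value = CIndex-value (proj₁ (proj₂ (proj₂ conjecture))) y
        w = proj₁ value
        w-bit : IsBit w
        w-bit = proj₁ (proj₂ value)
        φcw : φ c y w
        φcw = proj₂ (proj₂ value)
        φey : φ e y (isZero w)
        φey = Equivalence.from (e-fixed y (isZero w))
          (diagonalᵖ-odd {b = diagBits} {n = n₀} (λ p _ _ → proj₂ (diagBits-spec p)) (proj₁ (proj₂ conjecture)) φcw)

  contradiction : ⊥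
  contradiction = ¬¬-values-bounded (λ j y → φ j 0 y) φ-functional e (λ (B , bounded) → absurd B bounded)

theorem8 : (φ : Numbering) → Acceptable φ →
    Σ Class λ 𝓛 → ⊆REC 𝓛 × LearnableBy It (ExC φ) 𝓛 × ¬ LearnableBy G (CInd φ ∧ BcC φ) 𝓛
theorem8 φ acc = SelfDescribing φ , (λ L → proj₁) , SelfDescribing-It-learnable φ ,
  λ (h , h-learns) → NotLearnable.contradiction φ acc h h-learns
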